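{- $\mathcal{E}_n^{\mathcal{A}^{\mathrm{q\text{ - }sort}},\mathrm{adpt}}(2)=0$: against every adaptive adversarial comparator and every input, quick-sort outputs an ordering $(Y_1,\dots,Y_n)$ with $Y_i-Y_j\le 2$ for all $i>j$, with probability $1$.
   Context: Model: there are $n$ items with real values (a multiset $\mathcal{X}$). A faulty comparator on two distinct inputs returns the larger if their values differ by more than $1$, and otherwise either one, possibly adversarially; an adaptive adversarial comparator may choose each outcome depending on all previous queries and outcomes. A sorting algorithm outputs an ordering $(Y_1,\dots,Y_n)$ of the inputs (intended to be decreasing); its $t$-approximation error is $\mathcal{E}_n^{\mathcal{A}}(t)=\Pr(\max_{i>j}(Y_i-Y_j)>t)$, and $\mathcal{E}_n^{\mathcal{A},\mathrm{adpt}}(t)$ is its maximum over adaptive adversarial comparators and inputs. Quick-sort $\mathcal{A}^{\mathrm{q\text{ - }sort}}$: if at most one input, output it; otherwise choose a pivot uniformly at random, compare it with every other input, recursively sort the inputs that beat the pivot and those that lose to it, and output the sorted winners, then the pivot, then the sorted losers.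
   Formalization: The values of the n items are rational numbers rather than real numbers. -}

module Defs where

open import Data.Nat using (ℕ; _≤_)
open import Data.Fin using (Fin)
open import Data.List using (List; []; _∷_; _++_; length; [_])
open import Data.Rational using (ℚ; 1ℚ; _+_; _-_; _<_)
open import Relation.Nullary using (¬_)

-- Valid outcomes of the faulty comparator comparing an item of value x with
-- a pivot of value p.  "x beats p" may be reported unless p exceeds x by more
-- than 1; "x loses to p" may be reported unless x exceeds p by more than 1.
-- Within tolerance 1 either outcome may be reported (adversarially/adaptively).
MayWin : ℚ → ℚ → Set
MayWin x p = ¬ (1ℚ < p - x)

MayLose : ℚ → ℚ → Set
MayLose x p = ¬ (1ℚ < x - p)

data Split (p : ℚ) : List ℚ → List ℚ → List ℚ → Set where
  split-nil  : Split p [] [] []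
  split-win  : ∀ {x xs W L} → MayWin x p  → Split p xs W L → Split p (x ∷ xs) (x ∷ W) L
  split-lose : ∀ {x xs W L} → MayLose x p → Split p xs W L → Split p (x ∷ xs) W (x ∷ L)

-- QuickSort xs ys : ys is an output that quick-sort can produce on input
-- (multiset, given as a list of values) xs for SOME pivot choices and SOME
-- sequence of valid comparator answers.  Every realisation of the random
-- pivots against any adaptive adversarial comparator is such a run, and
-- conversely every such run occurs with positive probability for some adaptive
-- adversary; hence "error 0 with probability 1 for all adaptive adversaries"
-- is "every run satisfies the bound".
data QuickSort : List ℚ → List ℚ → Set where
  qs-nil   : QuickSort [] []
  qs-one   : ∀ x → QuickSort [ x ] [ x ]
  qs-pivot : ∀ {pre post p W L Ws Ls} →
             2 ≤ length (pre ++ p ∷ post) →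
             Split p (pre ++ post) W L →
             QuickSort W Ws → QuickSort L Ls →
             QuickSort (pre ++ p ∷ post) (Ws ++ p ∷ Ls)

two : ℚ
two = 1ℚ + 1ℚ

{-# OPTIONS --safe #-}
module Submission where

-- Every item that beats the pivot is at least the pivot minus 1 and every
-- item that loses to it is at most the pivot plus 1, so in the output
-- Ws ++ p ∷ Ls an item of Ls exceeds an item of Ws by at most 2.  Quick-sort
-- only permutes, so these bounds survive the recursive calls, and induction
-- on the run shows that no later item exceeds an earlier one by more than 2.

open import Defs
open import Data.List using (List; length; lookup; _∷_; _++_)
open import Data.List.Membership.Propositional.Properties using (∈-lookup)
open import Data.List.Relation.Binary.Permutation.Propositional
  using (_↭_; prep; ↭-refl; ↭-sym; ↭-trans; module PermutationReasoning)
open import Data.List.Relation.Binary.Permutation.Propositional.Properties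
  using (All-resp-↭; shift; ++⁺)
open import Data.List.Relation.Unary.All as All using (All; []; _∷_)
open import Data.List.Relation.Unary.AllPairs using (AllPairs; []; _∷_)
import Data.List.Relation.Unary.AllPairs.Properties as AllPairs
open import Data.Fin using (Fin; _<_; zero; suc)
open import Data.Nat using (s<s)
open import Data.Rational using (ℚ; _-_; _≤_; 1ℚ; _+_)
open import Data.Rational.Properties using (≮⇒≥; +-mono-≤; ≤-trans; _≤?_)
open import Data.Rational.Solver using (module +-*-Solver)
open import Relation.Binary.PropositionalEquality using (_≡_; refl; subst; sym)
open import Relation.Nullary.Decidable using (toWitness)

AllPairs-lookup : ∀ {A : Set} {R : A → A → Set} {xs : List A} → AllPairs R xs →
                  {i j : Fin (length xs)} → j < i → R (lookup xs j) (lookup xs i)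
AllPairs-lookup (Rx ∷ _)  {suc i} {zero}  _         = All.lookup Rx (∈-lookup i)
AllPairs-lookup (_ ∷ Rxs) {suc i} {suc j} (s<s j<i) = AllPairs-lookup Rxs j<i

AllPairs-++-pivot : ∀ {A : Set} {S R : A → A → Set} {p : A} {ws ls : List A} →
                    (∀ {x y} → S x y → R x y) →
                    (∀ {w l} → S w p → S p l → R w l) →
                    All (λ w → S w p) ws → All (S p) ls →
                    AllPairs R ws → AllPairs R ls → AllPairs R (ws ++ p ∷ ls)
AllPairs-++-pivot S⇒R S-trans Swp Spl Rws Rls =
  AllPairs.++⁺ Rws (All.map S⇒R Spl ∷ Rls)
    (All.map (λ Sw → S⇒R Sw ∷ All.map (S-trans Sw) Spl) Swp)

-- A record rather than the bare inequality so that x and y can be inferred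
-- (unification cannot invert _-_).
record _≳⟨_⟩_ (x t y : ℚ) : Set where
  constructor within
  field excess≤ : y - x ≤ t

open _≳⟨_⟩_ using (excess≤)

≳-weaken : ∀ {s t x y} → s ≤ t → x ≳⟨ s ⟩ y → x ≳⟨ t ⟩ y
≳-weaken s≤t (within y-x≤s) = within (≤-trans y-x≤s s≤t)

≳-trans : ∀ {s t x y z} → x ≳⟨ s ⟩ y → y ≳⟨ t ⟩ z → x ≳⟨ s + t ⟩ z
≳-trans {x = x} {y} {z} (within y-x≤s) (within z-y≤t) =
  within (subst (_≤ _) (sym (telescope z y x)) (+-mono-≤ y-x≤s z-y≤t))
  where
  open +-*-Solver
  telescope : ∀ z y x → z - x ≡ (y - x) + (z - y)
  telescope = solve 3 (λ z y x → z :- x := (y :- x) :+ (z :- y)) refl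

split-↭ : ∀ {p xs W L} → Split p xs W L → xs ↭ W ++ L
split-↭ split-nil       = ↭-refl
split-↭ (split-win _ s) = prep _ (split-↭ s)
split-↭ (split-lose {x = x} {W = W} {L} _ s) =
  ↭-trans (prep x (split-↭ s)) (↭-sym (shift x W L))

split-winners : ∀ {p xs W L} → Split p xs W L → All (_≳⟨ 1ℚ ⟩ p) W
split-winners split-nil             = []
split-winners (split-win may-win s) = within (≮⇒≥ may-win) ∷ split-winners s
split-winners (split-lose _ s)      = split-winners s

split-losers : ∀ {p xs W L} → Split p xs W L → All (p ≳⟨ 1ℚ ⟩_) L
split-losers split-nil               = []
split-losers (split-win _ s)         = split-losers s
split-losers (split-lose may-lose s) = within (≮⇒≥ may-lose) ∷ split-losers s

quickSort-↭ : ∀ {xs ys} → QuickSort xs ys → xs ↭ ys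
quickSort-↭ qs-nil     = ↭-refl
quickSort-↭ (qs-one _) = ↭-refl
quickSort-↭ (qs-pivot {pre = pre} {post} {p} {W} {L} {Ws} {Ls} _ s qW qL) = begin
  pre ++ p ∷ post  ↭⟨ shift p pre post ⟩
  p ∷ pre ++ post  ↭⟨ prep p (split-↭ s) ⟩
  p ∷ W ++ L       ↭⟨ prep p (++⁺ (quickSort-↭ qW) (quickSort-↭ qL)) ⟩
  p ∷ Ws ++ Ls     ↭⟨ shift p Ws Ls ⟨
  Ws ++ p ∷ Ls     ∎
  where open PermutationReasoning

1≤two : 1ℚ ≤ two
1≤two = toWitness {a? = 1ℚ ≤? two} _

quickSort-sorted-within-two : ∀ {xs ys} → QuickSort xs ys → AllPairs _≳⟨ two ⟩_ ys
quickSort-sorted-within-two qs-nil     = []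
quickSort-sorted-within-two (qs-one _) = [] ∷ []
quickSort-sorted-within-two (qs-pivot _ s qW qL) =
  AllPairs-++-pivot (≳-weaken 1≤two) ≳-trans
    (All-resp-↭ (quickSort-↭ qW) (split-winners s))
    (All-resp-↭ (quickSort-↭ qL) (split-losers s))
    (quickSort-sorted-within-two qW) (quickSort-sorted-within-two qL)

lemma11 : (xs ys : List ℚ) → QuickSort xs ys →
          (i j : Fin (length ys)) → j < i →
          lookup ys i - lookup ys j ≤ two
lemma11 _ _ q _ _ j<i = excess≤ (AllPairs-lookup (quickSort-sorted-within-two q) j<i)
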